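{- If $G$ is a connected graph and $C(G)$ is its central graph, then $\chi''_{D}(C(G))$ equals either $\Delta(C(G))+1$ or $\Delta(C(G))+2$.
   Context: All graphs are simple, finite, undirected. The central graph $C(G)$ has vertex set $V(G)\cup\{w_{u,v}:\{u,v\}\in E(G)\}$ and edge set consisting of all pairs $\{u,v\}$ of distinct non-adjacent vertices of $G$, together with $\{u,w_{u,v}\}$ and $\{w_{u,v},v\}$ for every $\{u,v\}\in E(G)$. $\Delta(H)$ is the maximum degree of $H$. A total coloring of $H$ colors its vertices and edges; it is proper if adjacent vertices, adjacent edges, and incident vertex-edge pairs receive different colors. An automorphism $\phi$ of $H$ preserves a total coloring $f$ if $f(\phi(x))=f(x)$ for all vertices and edges $x$. The total distinguishing chromatic number $\chi''_D(H)$ is the least $d$ such that $H$ has a proper total coloring with $d$ colors preserved only by the identity automorphism. -}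

module Defs where

open import Data.Nat using (ℕ; zero; suc; _<_; _≤_; _+_)
open import Data.Nat.Base using (_<ᵇ_)
open import Data.Fin using (Fin; toℕ)
open import Data.Fin.Properties using (_≟_)
open import Data.Bool using (Bool; true; false; T; not; _∧_; _∨_)
open import Data.Sum using (_⊎_; inj₁; inj₂)
open import Data.Product using (Σ; _×_; _,_; ∃)
open import Relation.Binary.PropositionalEquality using (_≡_; _≢_)
open import Relation.Nullary using (¬_)
open import Relation.Nullary.Decidable using (⌊_⌋)
open import Function.Bundles using (_↔_)

record SimpleGraph : Set where
  field
    n      : ℕ
    adj    : Fin n → Fin n → Bool
    sym    : ∀ u v → adj u v ≡ adj v u
    irrefl : ∀ v → adj v v ≡ false
open SimpleGraph public

-- walks, connectedness (connected graphs are nonempty by convention)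
data Walk (G : SimpleGraph) : Fin (n G) → Fin (n G) → Set where
  here : ∀ {u} → Walk G u u
  step : ∀ {u v w} → T (adj G u v) → Walk G v w → Walk G u w

Connected : SimpleGraph → Set
Connected G = (0 < n G) × (∀ u v → Walk G u v)

record Graph : Set₁ where
  field
    V   : Set
    Adj : V → V → Bool
open Graph public

EdgeVertex : SimpleGraph → Set
EdgeVertex G = Σ (Fin (n G) × Fin (n G))
  (λ { (u , v) → T ((toℕ u <ᵇ toℕ v) ∧ adj G u v) })
  -- w_{u,v} for the edge {u,v}, represented by its pair with u < v

private
  _==_ : ∀ {m} → Fin m → Fin m → Bool
  a == b = ⌊ a ≟ b ⌋

centralAdj : (G : SimpleGraph) → Fin (n G) ⊎ EdgeVertex G → Fin (n G) ⊎ EdgeVertex G → Bool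
centralAdj G (inj₁ u) (inj₁ v) = not (adj G u v) ∧ not (u == v)
centralAdj G (inj₁ u) (inj₂ ((a , b) , _)) = (u == a) ∨ (u == b)
centralAdj G (inj₂ ((a , b) , _)) (inj₁ u) = (u == a) ∨ (u == b)
centralAdj G (inj₂ _) (inj₂ _) = false

Central : SimpleGraph → Graph
Central G = record { V = Fin (n G) ⊎ EdgeVertex G ; Adj = centralAdj G }

Neighbours : (H : Graph) → V H → Set
Neighbours H v = Σ (V H) (λ w → T (Adj H v w))

HasDegree : (H : Graph) → V H → ℕ → Set
HasDegree H v k = Neighbours H v ↔ Fin k

IsMaxDegree : Graph → ℕ → Set
IsMaxDegree H k =
  (Σ (V H) λ v → HasDegree H v k) ×
  (∀ v j → HasDegree H v j → j ≤ k)

record TotalColoring (H : Graph) (d : ℕ) : Set where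
  field
    vcol    : V H → Fin d
    ecol    : (u v : V H) → T (Adj H u v) → Fin d
    ecolSym : ∀ u v p q → ecol u v p ≡ ecol v u q
open TotalColoring public

record IsProper {H : Graph} {d : ℕ} (f : TotalColoring H d) : Set where
  field
    vertexProper : ∀ u v → T (Adj H u v) → vcol f u ≢ vcol f v
    edgeProper   : ∀ u v w (p : T (Adj H u v)) (q : T (Adj H u w)) →
                   v ≢ w → ecol f u v p ≢ ecol f u w q
    incidence    : ∀ u v (p : T (Adj H u v)) → ecol f u v p ≢ vcol f u

record Automorphism (H : Graph) : Set where
  field
    φ        : V H → V H
    φ⁻¹      : V H → V H
    left     : ∀ v → φ⁻¹ (φ v) ≡ v
    right    : ∀ v → φ (φ⁻¹ v) ≡ v
    preserve : ∀ u v → Adj H (φ u) (φ v) ≡ Adj H u v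
open Automorphism public

Preserves : {H : Graph} {d : ℕ} → Automorphism H → TotalColoring H d → Set
Preserves {H} a f =
  (∀ v → vcol f (φ a v) ≡ vcol f v) ×
  (∀ u v (p : T (Adj H u v)) (q : T (Adj H (φ a u) (φ a v))) →
     ecol f (φ a u) (φ a v) q ≡ ecol f u v p)

IsDistinguishing : {H : Graph} {d : ℕ} → TotalColoring H d → Set
IsDistinguishing {H} f =
  (a : Automorphism H) → Preserves a f → ∀ v → φ a v ≡ v

HasTDColoring : Graph → ℕ → Set
HasTDColoring H d =
  Σ (TotalColoring H d) λ f → IsProper f × IsDistinguishing f

IsTDChromaticNumber : Graph → ℕ → Set
IsTDChromaticNumber H d =
  HasTDColoring H d × (∀ e → e < d → ¬ HasTDColoring H e)

{-# OPTIONS --safe #-}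
-- The original vertices of C(G) have degree n - 1 and the edge vertices degree 2, and a proper
-- total coloring needs Δ + 1 colors around a vertex of maximum degree.  So it suffices to exhibit
-- a distinguishing total coloring with Δ + 2 colors and to decide, by exhaustive search over the
-- finite graph C(G), whether Δ + 1 colors already suffice.
-- Our colorings use n + 1 ≤ Δ + 2 colors and give the original vertices pairwise distinct
-- colors.  An edge vertex is determined by its two ends, so an automorphism fixing the original
-- vertices is the identity; it remains to see that no original vertex is moved to an edge vertex.
-- For n ≤ 3 every vertex has at most one non-neighbour in G, which lets all edge vertices share one
-- extra color.  For n ≥ 4 colors are taken modulo n + 1, at least five colors leave every edge
-- vertex a free color, and degrees separate the two kinds of vertices.

module Submission where

open import Defs hiding (sym)
open import Data.Bool using (true; false; T; not; _∧_)
open import Data.Bool.Properties using (T-irrelevant; T-∧; T-∨; T-not-≡)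
  renaming (_≟_ to _≟ᵇ_)
open import Data.Empty using (⊥-elim)
open import Data.Fin
  using (Fin; zero; suc; toℕ; _<_; _≤_; inject; inject≤; inject₁; fromℕ; fromℕ<; punchIn; punchOut)
open import Data.Fin.Properties
  using (any?; all?; _<?_; ¬∀⟶∃¬; ¬∀⟶∃¬-smallest; <-irrefl; <-asym; <-cmp; injective⇒≤; *↔×; +↔⊎;
         toℕ<n; toℕ-injective; toℕ-inject; toℕ-fromℕ<; inject₁-injective; inject≤-injective;
         fromℕ≢inject₁; punchInᵢ≢i; punchOut-cong; punchOut-punchIn; punchIn-punchOut; punchOut-injective)
  renaming (_≟_ to _≟ᶠ_)
open import Data.Fin.Permutation using (↔⇒≡)
open import Data.Nat using (ℕ; zero; suc; s≤s; z≤n; _*_; _+_; _∸_; pred; s≤s⁻¹; _<ᵇ_)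
  renaming (_<_ to _<ℕ_; _≤_ to _≤ℕ_)
open import Data.Nat.Properties
  using (≤-refl; n≤1+n; pred-mono-≤; <⇒≱; ≮⇒≥; <⇒≤; ≤-antisym; <ᵇ⇒<; <⇒<ᵇ;
         +-comm; +-assoc; m∸n+n≡m)
open import Data.Nat.DivMod using (_%_; _mod_; %-distribˡ-+; [m+n]%n≡m%n; m<n⇒m%n≡m)
open import Data.Product using (Σ; ∃; _×_; _,_; proj₁; proj₂)
import Data.Product as Product
open import Data.Product.Function.NonDependent.Propositional using (_×-↩_)
open import Data.Sum using (_⊎_; inj₁; inj₂)
import Data.Sum as Sum
open import Data.Sum.Function.Propositional using (_⊎-↔_)
open import Data.Unit using (tt)
open import Data.Vec.Functional using ([]; _∷_; head; tail)
open import Function using (_∘_; id; case_of_)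
open import Function.Bundles using (_↔_; _↩_; mk↔ₛ′; mk↩; Inverse; LeftInverse; Equivalence)
open import Function.Construct.Composition using (_↩-∘_; _↔-∘_)
open import Function.Construct.Identity using (↔-id)
open import Function.Construct.Symmetry using (↔-sym)
open import Function.Definitions using (Injective)
open import Function.Properties.Inverse using (↔⇒↩)
open import Relation.Binary.Definitions using (DecidableEquality; tri<; tri≈; tri>)
open import Relation.Binary.PropositionalEquality
  using (_≡_; _≢_; refl; sym; trans; cong; cong₂; subst; subst₂; module ≡-Reasoning)
open import Relation.Nullary using (Dec; yes; no; ¬_)
open import Relation.Nullary.Decidable
  using (map′; ¬?; decidable-stable; _×-dec_; _→-dec_; ⌊_⌋; T?;
         toWitness; fromWitness; toWitnessFalse; fromWitnessFalse)
open import Relation.Unary using (Pred; Decidable)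
open import Level using (0ℓ)

-- Exhaustive search

Exhaustible : Set → Set₁
Exhaustible A = ∀ {P : Pred A 0ℓ} → Decidable P → Dec (∃ P)

Extensional : {A B : Set} → Pred (A → B) 0ℓ → Set
Extensional Q = ∀ {f g} → (∀ x → f x ≡ g x) → Q f → Q g

Fin-exhaustible : ∀ {k} → Exhaustible (Fin k)
Fin-exhaustible = any?

search-Fin→ : ∀ k {B : Set} → Exhaustible B → {Q : Pred (Fin k → B) 0ℓ} →
              Extensional Q → Decidable Q → Dec (∃ Q)
search-Fin→ zero B? ext Q? = map′ (_ ,_) (λ (f , q) → ext (λ ()) q) (Q? (λ ()))
search-Fin→ (suc k) B? {Q} ext Q? =
  map′ (λ (b , g , q) → b ∷ g , q)
       (λ (f , q) → head f , tail f , ext (λ { zero → refl ; (suc i) → refl }) q)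
       (B? λ b → search-Fin→ k B? (λ eq → ext λ { zero → refl ; (suc i) → eq i })
                                   (λ g → Q? (b ∷ g)))

module FinRetract {A : Set} {k : ℕ} (r : Fin k ↩ A) where
  open LeftInverse r using (to; from; strictlyInverseˡ)

  exhaustible : Exhaustible A
  exhaustible {P} P? =
    map′ (λ (i , p) → to i , p)
         (λ (a , p) → from a , subst P (sym (strictlyInverseˡ a)) p)
         (any? (P? ∘ to))

  all-dec : ∀ {P : Pred A 0ℓ} → Decidable P → Dec (∀ a → P a)
  all-dec {P} P? =
    map′ (λ h a → subst P (strictlyInverseˡ a) (h (from a))) (λ h → h ∘ to) (all? (P? ∘ to))

  _≟_ : DecidableEquality A
  a ≟ b = map′ (λ e → trans (sym (strictlyInverseˡ a)) (trans (cong to e) (strictlyInverseˡ b)))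
               (cong from) (from a ≟ᶠ from b)

  search→ : ∀ {B : Set} → Exhaustible B → {Q : Pred (A → B) 0ℓ} →
            Extensional Q → Decidable Q → Dec (∃ Q)
  search→ B? ext Q? =
    map′ (λ (g , q) → g ∘ from , q)
         (λ (f , q) → f ∘ to , ext (λ a → cong f (sym (strictlyInverseˡ a))) q)
         (search-Fin→ k B? (λ eq → ext (eq ∘ from)) (λ g → Q? (g ∘ from)))

Π-T? : ∀ b {X : T b → Set} → (∀ p → Dec (X p)) → Dec (∀ p → X p)
Π-T? false X? = yes λ ()
Π-T? true  X? = map′ (λ x _ → x) (λ h → h tt) (X? tt)

-- Finite sets

Fin2-≢-unique : ∀ {x y u : Fin 2} → x ≢ u → y ≢ u → x ≡ y
Fin2-≢-unique {zero}     {zero}                 _   _   = refl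
Fin2-≢-unique {suc zero} {suc zero}             _   _   = refl
Fin2-≢-unique {zero}     {suc zero} {zero}      x≢u _   = ⊥-elim (x≢u refl)
Fin2-≢-unique {zero}     {suc zero} {suc zero}  _   y≢u = ⊥-elim (y≢u refl)
Fin2-≢-unique {suc zero} {zero}     {zero}      _   y≢u = ⊥-elim (y≢u refl)
Fin2-≢-unique {suc zero} {zero}     {suc zero}  x≢u _   = ⊥-elim (x≢u refl)

Fin3-≢-unique : ∀ {x y u z : Fin 3} →
                x ≢ u → y ≢ u → z ≢ u → x ≢ z → y ≢ z → x ≡ y
Fin3-≢-unique x≢u y≢u z≢u x≢z y≢z =
  punchOut-injective (x≢u ∘ sym) (y≢u ∘ sym)
    (Fin2-≢-unique (x≢z ∘ punchOut-injective (x≢u ∘ sym) (z≢u ∘ sym))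
                   (y≢z ∘ punchOut-injective (y≢u ∘ sym) (z≢u ∘ sym)))

punctured↔ : ∀ {n} {X : Set} (u : Fin n) (h : X → Fin n) → Injective _≡_ _≡_ h →
             (∀ x → h x ≢ u) → (∀ j → j ≢ u → ∃ λ x → h x ≡ j) → X ↔ Fin (pred n)
punctured↔ {suc m} u h h-injective h≢u h-onto = mk↔ₛ′ to from to-from from-to
  where
  to : _ → Fin m
  to x = punchOut (h≢u x ∘ sym)
  from : Fin m → _
  from i = proj₁ (h-onto (punchIn u i) (punchInᵢ≢i u i))
  to-from : ∀ i → to (from i) ≡ i
  to-from i = trans (punchOut-cong u (proj₂ (h-onto _ (punchInᵢ≢i u i)))) (punchOut-punchIn u)
  from-to : ∀ x → from (to x) ≡ x
  from-to x = h-injective (trans (proj₂ (h-onto _ _)) (punchIn-punchOut _))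

module _ {m : ℕ} where

  private
    M = suc m

  _⊕_ : Fin M → Fin M → Fin M
  a ⊕ b = (toℕ a + toℕ b) mod M

  ⊕-comm : ∀ a b → a ⊕ b ≡ b ⊕ a
  ⊕-comm a b = cong (_mod M) (+-comm (toℕ a) (toℕ b))

  ⊕-cancelˡ : ∀ a {x y} → a ⊕ x ≡ a ⊕ y → x ≡ y
  ⊕-cancelˡ a {x} {y} eq = toℕ-injective (begin
    toℕ x                                         ≡⟨ undo x ⟨
    (M ∸ toℕ a + (toℕ a + toℕ x)) % M             ≡⟨ %-distribˡ-+ (M ∸ toℕ a) _ M ⟩
    ((M ∸ toℕ a) % M + (toℕ a + toℕ x) % M) % M   ≡⟨ cong (λ s → ((M ∸ toℕ a) % M + s) % M) sum≡ ⟩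
    ((M ∸ toℕ a) % M + (toℕ a + toℕ y) % M) % M   ≡⟨ %-distribˡ-+ (M ∸ toℕ a) _ M ⟨
    (M ∸ toℕ a + (toℕ a + toℕ y)) % M             ≡⟨ undo y ⟩
    toℕ y                                         ∎)
    where
    open ≡-Reasoning
    sum≡ : (toℕ a + toℕ x) % M ≡ (toℕ a + toℕ y) % M
    sum≡ = trans (sym (toℕ-fromℕ< _)) (trans (cong toℕ eq) (toℕ-fromℕ< _))
    a≤M = <⇒≤ (toℕ<n a)
    undo : ∀ z → (M ∸ toℕ a + (toℕ a + toℕ z)) % M ≡ toℕ z
    undo z = begin
      (M ∸ toℕ a + (toℕ a + toℕ z)) % M ≡⟨ cong (_% M) (+-assoc (M ∸ toℕ a) _ _) ⟨
      (M ∸ toℕ a + toℕ a + toℕ z) % M   ≡⟨ cong (λ s → (s + toℕ z) % M) (m∸n+n≡m a≤M) ⟩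
      (M + toℕ z) % M                   ≡⟨ cong (_% M) (+-comm M (toℕ z)) ⟩
      (toℕ z + M) % M                   ≡⟨ [m+n]%n≡m%n (toℕ z) M ⟩
      toℕ z % M                         ≡⟨ m<n⇒m%n≡m (toℕ<n z) ⟩
      toℕ z                             ∎

missing-color : ∀ {k d} → k <ℕ d → (f : Fin k → Fin d) → ∃ λ c → ∀ i → f i ≢ c
missing-color {k} {d} k<d f with any? (λ c → all? (λ i → ¬? (f i ≟ᶠ c)))
... | yes found = found
... | no  none  = ⊥-elim (<⇒≱ k<d (injective⇒≤ preimage-injective))
  where
  hit : ∀ c → ∃ λ i → f i ≡ c
  hit c = Product.map₂ (decidable-stable (f _ ≟ᶠ c))
                       (¬∀⟶∃¬ k _ (λ i → ¬? (f i ≟ᶠ c)) (none ∘ (c ,_)))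
  preimage-injective : Injective _≡_ _≡_ (proj₁ ∘ hit)
  preimage-injective {c} {c'} eq = trans (sym (proj₂ (hit c))) (trans (cong f eq) (proj₂ (hit c')))

least-above : ∀ {n} {P : Pred (Fin n) 0ℓ} → Decidable P → (a : Fin n) →
              (∃ λ (y : Fin n) → a < y × P y × ∀ z → a < z → P z → y ≤ z) ⊎
              (∀ z → a < z → ¬ P z)
least-above {n} {P} P? a with all? (λ z → ¬? (a <? z ×-dec P? z))
... | yes none = inj₂ λ z a<z pz → none z (a<z , pz)
... | no  some with ¬∀⟶∃¬-smallest n _ (λ z → ¬? (a <? z ×-dec P? z)) some
...   | y , ¬¬above , below =
        let (a<y , py) = decidable-stable (a <? y ×-dec P? y) ¬¬above
        in inj₁ (y , a<y , py , λ z a<z pz → ≮⇒≥ λ z<y →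
             below (fromℕ< z<y) (subst (λ w → a < w × P w) (sym (inject-fromℕ< z<y)) (a<z , pz)))
  where
  inject-fromℕ< : ∀ {y z : Fin n} (z<y : z < y) → inject (fromℕ< z<y) ≡ z
  inject-fromℕ< z<y = toℕ-injective (trans (toℕ-inject (fromℕ< z<y)) (toℕ-fromℕ< z<y))

-- Degrees and total colorings

module _ {H : Graph} where

  neighbour-≡ : ∀ {v} {w w' : Neighbours H v} → proj₁ w ≡ proj₁ w' → w ≡ w'
  neighbour-≡ {w = w , p} {.w , q} refl = cong (w ,_) (T-irrelevant p q)

  ecol-cong : ∀ {d u u' v v'} (f : TotalColoring H d) (p : T (Adj H u v)) (q : T (Adj H u' v')) →
              u ≡ u' → v ≡ v' → ecol f u v p ≡ ecol f u' v' q
  ecol-cong f p q refl refl = cong (ecol f _ _) (T-irrelevant p q)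

  degree-unique : ∀ {v j k} → HasDegree H v j → HasDegree H v k → j ≡ k
  degree-unique dj dk = ↔⇒≡ (dk ↔-∘ ↔-sym dj)

  isMaxDegree : ∀ {Δ} (v₀ : V H) → HasDegree H v₀ Δ →
                (∀ v → ∃ λ j → HasDegree H v j × j ≤ℕ Δ) → IsMaxDegree H Δ
  isMaxDegree {Δ} v₀ d₀ bounded = (v₀ , d₀) , λ v j dj →
    let (i , di , i≤Δ) = bounded v in subst (_≤ℕ Δ) (degree-unique di dj) i≤Δ

  degree<colors : ∀ {v k d} → HasDegree H v k → (f : TotalColoring H d) → IsProper f → k <ℕ d
  degree<colors {v} {k} {d} dk f proper = injective⇒≤ color-injective
    where
    open Inverse dk using (to; from; strictlyInverseˡ)
    open IsProper proper
    color : Fin (suc k) → Fin d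
    color zero    = vcol f v
    color (suc i) = ecol f v (proj₁ (from i)) (proj₂ (from i))
    color-injective : Injective _≡_ _≡_ color
    color-injective {zero}  {zero}  _  = refl
    color-injective {zero}  {suc j} eq = ⊥-elim (incidence v _ _ (sym eq))
    color-injective {suc i} {zero}  eq = ⊥-elim (incidence v _ _ eq)
    color-injective {suc i} {suc j} eq with i ≟ᶠ j
    ... | yes i≡j = cong suc i≡j
    ... | no  i≢j = ⊥-elim (edgeProper v _ _ _ _ distinct eq)
      where
      distinct : proj₁ (from i) ≢ proj₁ (from j)
      distinct w≡w' = i≢j (trans (sym (strictlyInverseˡ i))
        (trans (cong to (neighbour-≡ {v = v} w≡w')) (strictlyInverseˡ j)))

φ-injective : ∀ {H} (a : Automorphism H) {x y} → φ a x ≡ φ a y → x ≡ y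
φ-injective a {x} {y} eq = trans (sym (left a x)) (trans (cong (φ⁻¹ a) eq) (left a y))

degree-preserved : ∀ {H v k} (a : Automorphism H) → HasDegree H v k → HasDegree H (φ a v) k
degree-preserved {H} {v} a dk = dk ↔-∘ mk↔ₛ′ pull push pull-push push-pull
  where
  pull : Neighbours H (φ a v) → Neighbours H v
  pull (w , p) =
    φ⁻¹ a w , subst T (trans (cong (Adj H (φ a v)) (sym (right a w))) (preserve a v _)) p
  push : Neighbours H v → Neighbours H (φ a v)
  push (w , p) = φ a w , subst T (sym (preserve a v w)) p
  pull-push : ∀ w → pull (push w) ≡ w
  pull-push (w , p) = neighbour-≡ {H} {v} (left a w)
  push-pull : ∀ w → push (pull w) ≡ w
  push-pull (w , p) = neighbour-≡ {H} {φ a v} (right a w)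

module _ {H : Graph} {d e} {f : TotalColoring H d} {g : TotalColoring H e}
         {c : Fin d → Fin e} (c-injective : Injective _≡_ _≡_ c)
         (vcol-g : ∀ v → vcol g v ≡ c (vcol f v))
         (ecol-g : ∀ u v p → ecol g u v p ≡ c (ecol f u v p)) where

  private
    reflect : ∀ {x y x' y'} → x' ≡ c x → y' ≡ c y → x' ≡ y' → x ≡ y
    reflect x' y' eq = c-injective (trans (sym x') (trans eq y'))

  isProper-recolor : IsProper f → IsProper g
  isProper-recolor proper = record
    { vertexProper = λ u v p → vertexProper u v p ∘ reflect (vcol-g u) (vcol-g v)
    ; edgeProper   = λ u v w p q v≢w →
                       edgeProper u v w p q v≢w ∘ reflect (ecol-g u v p) (ecol-g u w q)
    ; incidence    = λ u v p → incidence u v p ∘ reflect (ecol-g u v p) (vcol-g u)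
    }
    where open IsProper proper

  isDistinguishing-recolor : IsDistinguishing f → IsDistinguishing g
  isDistinguishing-recolor distinguishing a (pv , pe) = distinguishing a
    ( (λ v → reflect (vcol-g (φ a v)) (vcol-g v) (pv v))
    , (λ u v p q → reflect (ecol-g (φ a u) (φ a v) q) (ecol-g u v p) (pe u v p q)) )

  isTD-recolor : IsProper f × IsDistinguishing f → IsProper g × IsDistinguishing g
  isTD-recolor (proper , distinguishing) =
    isProper-recolor proper , isDistinguishing-recolor distinguishing

hasTDColoring-mono : ∀ {H d e} → d ≤ℕ e → HasTDColoring H d → HasTDColoring H e
hasTDColoring-mono {e = e} d≤e (f , td) =
  f' , isTD-recolor (λ {i} {j} → inject≤-injective d≤e d≤e i j) (λ _ → refl) (λ _ _ _ → refl) td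
  where
  f' : TotalColoring _ e
  f' = record { vcol    = λ v → inject≤ (vcol f v) d≤e
              ; ecol    = λ u v p → inject≤ (ecol f u v p) d≤e
              ; ecolSym = λ u v p q → cong (λ i → inject≤ i d≤e) (ecolSym f u v p q) }

isTDChromaticNumber-Δ+1⊎Δ+2 : ∀ {H Δ} (v : V H) → HasDegree H v Δ →
  HasTDColoring H (suc (suc Δ)) → Dec (HasTDColoring H (suc Δ)) →
  IsTDChromaticNumber H (suc Δ) ⊎ IsTDChromaticNumber H (suc (suc Δ))
isTDChromaticNumber-Δ+1⊎Δ+2 v dv _ (yes fewer) =
  inj₁ (fewer , λ e e<Δ+1 (f , proper , _) → <⇒≱ e<Δ+1 (degree<colors dv f proper))
isTDChromaticNumber-Δ+1⊎Δ+2 {H} v dv more (no ¬fewer) =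
  inj₂ (more , λ e e<Δ+2 he@(f , proper , _) →
    ¬fewer (subst (HasTDColoring H) (≤-antisym (s≤s⁻¹ e<Δ+2) (degree<colors dv f proper)) he))

connected⇒neighbour : ∀ {G} → Connected G → ∀ u v → u ≢ v → ∃ (T ∘ adj G u)
connected⇒neighbour (_ , walk) u v u≢v with walk u v
... | here     = ⊥-elim (u≢v refl)
... | step p _ = _ , p

module FiniteGraph (H : Graph) {k} (r : Fin k ↩ V H) where

  private
    VH = V H
    open FinRetract r using (all-dec; _≟_; search→)
    pairs : Fin (k * k) ↩ (VH × VH)
    pairs = (r ×-↩ r) ↩-∘ ↔⇒↩ *↔×
    open FinRetract pairs
      using () renaming (exhaustible to pairs-exhaustible; search→ to search-pairs→)

  isProper? : ∀ {d} (f : TotalColoring H d) → Dec (IsProper f)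
  isProper? f =
    map′ (λ (vp , ep , ip) → record { vertexProper = vp ; edgeProper = ep ; incidence = ip })
         (λ P → IsProper.vertexProper P , IsProper.edgeProper P , IsProper.incidence P)
         (all-dec (λ u → all-dec λ v → Π-T? (Adj H u v) λ p →
            ¬? (vcol f u ≟ᶠ vcol f v)) ×-dec
          all-dec (λ u → all-dec λ v → all-dec λ w → Π-T? (Adj H u v) λ p → Π-T? (Adj H u w) λ q →
            ¬? (v ≟ w) →-dec ¬? (ecol f u v p ≟ᶠ ecol f u w q)) ×-dec
          all-dec (λ u → all-dec λ v → Π-T? (Adj H u v) λ p →
            ¬? (ecol f u v p ≟ᶠ vcol f u)))

  MovingSymmetry : ∀ {d} → TotalColoring H d → (VH → VH) → (VH → VH) → Set
  MovingSymmetry f φ ψ =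
    (∀ v → ψ (φ v) ≡ v) × (∀ v → φ (ψ v) ≡ v) ×
    (∀ u v → Adj H (φ u) (φ v) ≡ Adj H u v) ×
    ((∀ v → vcol f (φ v) ≡ vcol f v) ×
     (∀ u v (p : T (Adj H u v)) (q : T (Adj H (φ u) (φ v))) →
        ecol f (φ u) (φ v) q ≡ ecol f u v p)) ×
    ∃ λ v → φ v ≢ v

  movingSymmetry-resp : ∀ {d} (f : TotalColoring H d) {φ φ' ψ ψ'} →
                        (∀ v → φ v ≡ φ' v) → (∀ v → ψ v ≡ ψ' v) →
                        MovingSymmetry f φ ψ → MovingSymmetry f φ' ψ'
  movingSymmetry-resp f {φ} {φ'} {ψ} {ψ'} φ≈ ψ≈ (left , right , adj , (pv , pe) , v , moved) =
    (λ v → trans (sym (ψ≈ (φ' v))) (trans (cong ψ (sym (φ≈ v))) (left v))) ,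
    (λ v → trans (sym (φ≈ (ψ' v))) (trans (cong φ (sym (ψ≈ v))) (right v))) ,
    (λ u v → trans (sym (cong₂ (Adj H) (φ≈ u) (φ≈ v))) (adj u v)) ,
    ((λ v → trans (cong (vcol f) (sym (φ≈ v))) (pv v)) ,
     (λ u v p q → trans (ecol-cong f q (subst T (sym (adj u v)) p) (sym (φ≈ u)) (sym (φ≈ v)))
                        (pe u v p _))) ,
    v , moved ∘ trans (φ≈ v)

  movingSymmetry? : ∀ {d} (f : TotalColoring H d) φ ψ → Dec (MovingSymmetry f φ ψ)
  movingSymmetry? f φ ψ =
    all-dec (λ v → ψ (φ v) ≟ v) ×-dec all-dec (λ v → φ (ψ v) ≟ v) ×-dec
    all-dec (λ u → all-dec λ v → Adj H (φ u) (φ v) ≟ᵇ Adj H u v) ×-dec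
    (all-dec (λ v → vcol f (φ v) ≟ᶠ vcol f v) ×-dec
     all-dec (λ u → all-dec λ v → Π-T? (Adj H u v) λ p → Π-T? (Adj H (φ u) (φ v)) λ q →
       ecol f (φ u) (φ v) q ≟ᶠ ecol f u v p)) ×-dec
    FinRetract.exhaustible r (λ v → ¬? (φ v ≟ v))

  isDistinguishing? : ∀ {d} (f : TotalColoring H d) → Dec (IsDistinguishing f)
  isDistinguishing? f =
    map′ noMoving⇒distinguishing distinguishing⇒noMoving
      (¬? (search→ pairs-exhaustible
             (λ h≈ → movingSymmetry-resp f (cong proj₁ ∘ h≈) (cong proj₂ ∘ h≈))
             (λ h → movingSymmetry? f (proj₁ ∘ h) (proj₂ ∘ h))))
    where
    Moving : (VH → VH × VH) → Set
    Moving h = MovingSymmetry f (proj₁ ∘ h) (proj₂ ∘ h)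
    noMoving⇒distinguishing : ¬ ∃ Moving → IsDistinguishing f
    noMoving⇒distinguishing none a preserves v with φ a v ≟ v
    ... | yes fixed = fixed
    ... | no  moved = ⊥-elim (none ((λ v → φ a v , φ⁻¹ a v) ,
                                    left a , right a , preserve a , preserves , v , moved))
    distinguishing⇒noMoving : IsDistinguishing f → ¬ ∃ Moving
    distinguishing⇒noMoving distinguishing (h , l , r , adj , preserves , v , moved) =
      moved (distinguishing (record { φ = proj₁ ∘ h ; φ⁻¹ = proj₂ ∘ h
                                    ; left = l ; right = r ; preserve = adj }) preserves v)

  ArcSymmetric : ∀ {d} → (VH × VH → Fin d) → Set
  ArcSymmetric ec = ∀ u v → T (Adj H u v) → T (Adj H v u) → ec (u , v) ≡ ec (v , u)

  fromTables : ∀ {d} (vc : VH → Fin d) (ec : VH × VH → Fin d) → ArcSymmetric ec →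
               TotalColoring H d
  fromTables vc ec s = record { vcol = vc ; ecol = λ u v _ → ec (u , v) ; ecolSym = s }

  IsTDTable : ∀ {d} → (VH → Fin d) → (VH × VH → Fin d) → Set
  IsTDTable vc ec = Σ (ArcSymmetric ec) λ s →
    IsProper (fromTables vc ec s) × IsDistinguishing (fromTables vc ec s)

  isTDTable-resp : ∀ {d} {vc vc' : VH → Fin d} {ec ec'} →
                   (∀ v → vc v ≡ vc' v) → (∀ a → ec a ≡ ec' a) →
                   IsTDTable vc ec → IsTDTable vc' ec'
  isTDTable-resp vc≈ ec≈ (s , td) =
    s' , isTD-recolor id (sym ∘ vc≈) (λ u v _ → sym (ec≈ (u , v))) td
    where
    s' : ArcSymmetric _
    s' u v p q = trans (sym (ec≈ (u , v))) (trans (s u v p q) (ec≈ (v , u)))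

  isTDTable? : ∀ {d} (vc : VH → Fin d) ec → Dec (IsTDTable vc ec)
  isTDTable? vc ec
    with all-dec (λ u → all-dec λ v → Π-T? (Adj H u v) λ _ → Π-T? (Adj H v u) λ _ →
                   ec (u , v) ≟ᶠ ec (v , u))
  ... | no ¬s = no (¬s ∘ proj₁)
  ... | yes s = map′ (s ,_) (λ (_ , td) → isTD-recolor id (λ _ → refl) (λ _ _ _ → refl) td)
                     (isProper? (fromTables vc ec s) ×-dec isDistinguishing? (fromTables vc ec s))

  onArc : ∀ {A : Set} b → (T b → A) → A → A
  onArc true  g _ = g tt
  onArc false _ a = a

  onArc-T : ∀ {A : Set} b (g : T b → A) a (p : T b) → onArc b g a ≡ g p
  onArc-T true g a tt = refl

  tabulate : ∀ {d} → HasTDColoring H d → ∃ λ vc → ∃ (IsTDTable {d} vc)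
  tabulate (f , td) = vcol f , ec , s , isTD-recolor id (λ _ → refl) ec-f td
    where
    ec : VH × VH → Fin _
    ec (u , v) = onArc (Adj H u v) (ecol f u v) (vcol f u)
    ec-f : ∀ u v p → ec (u , v) ≡ ecol f u v p
    ec-f u v = onArc-T (Adj H u v) (ecol f u v) (vcol f u)
    s : ArcSymmetric ec
    s u v p q = trans (ec-f u v p) (trans (ecolSym f u v p q) (sym (ec-f v u q)))

  hasTDColoring? : ∀ d → Dec (HasTDColoring H d)
  hasTDColoring? d =
    map′ (λ (vc , ec , s , td) → fromTables vc ec s , td) tabulate
      (search→ Fin-exhaustible (λ vc≈ (ec , t) → ec , isTDTable-resp vc≈ (λ _ → refl) t)
        λ vc → search-pairs→ Fin-exhaustible (isTDTable-resp (λ _ → refl)) (isTDTable? vc))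

-- The central graph

module CentralGraph (G : SimpleGraph) where

  lower upper : EdgeVertex G → Fin (n G)
  lower ((a , _) , _) = a
  upper ((_ , b) , _) = b

  lower<upper : ∀ e → lower e < upper e
  lower<upper ((a , b) , p) = <ᵇ⇒< (toℕ a) (toℕ b) (proj₁ (Equivalence.to T-∧ p))

  lower-adj-upper : ∀ e → T (adj G (lower e) (upper e))
  lower-adj-upper ((a , b) , p) = proj₂ (Equivalence.to (T-∧ {toℕ a <ᵇ toℕ b}) p)

  lower≢upper : ∀ e → lower e ≢ upper e
  lower≢upper e eq = <-irrefl eq (lower<upper e)

  edgeVertex : ∀ {a b} → a < b → T (adj G a b) → EdgeVertex G
  edgeVertex {a} {b} a<b p = (a , b) , Equivalence.from T-∧ (<⇒<ᵇ a<b , p)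

  edgeVertex-≡ : ∀ e e' → lower e ≡ lower e' → upper e ≡ upper e' → e ≡ e'
  edgeVertex-≡ ((a , b) , p) ((.a , .b) , q) refl refl = cong ((a , b) ,_) (T-irrelevant p q)

  data _∈ₑ_ (u : Fin (n G)) (e : EdgeVertex G) : Set where
    at-lower : u ≡ lower e → u ∈ₑ e
    at-upper : u ≡ upper e → u ∈ₑ e

  incident⇒∈ₑ : ∀ u e → T (centralAdj G (inj₁ u) (inj₂ e)) → u ∈ₑ e
  incident⇒∈ₑ u e p = Sum.[ at-lower ∘ toWitness {a? = u ≟ᶠ lower e}
                          , at-upper ∘ toWitness {a? = u ≟ᶠ upper e} ] (Equivalence.to T-∨ p)

  ∈ₑ⇒incident : ∀ {u e} → u ∈ₑ e → T (centralAdj G (inj₁ u) (inj₂ e))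
  ∈ₑ⇒incident {u} {e} (at-lower u≡l) =
    Equivalence.from T-∨ (inj₁ (fromWitness {a? = u ≟ᶠ lower e} u≡l))
  ∈ₑ⇒incident {u} {e} (at-upper u≡h) =
    Equivalence.from (T-∨ {⌊ u ≟ᶠ lower e ⌋}) (inj₂ (fromWitness {a? = u ≟ᶠ upper e} u≡h))

  nonadjacent⇒≢ : ∀ {u x} → T (centralAdj G (inj₁ u) (inj₁ x)) → u ≢ x
  nonadjacent⇒≢ {u} {x} p =
    toWitnessFalse {a? = u ≟ᶠ x} (proj₂ (Equivalence.to (T-∧ {not (adj G u x)}) p))

  nonadjacent⇒adj≡false : ∀ {u x} → T (centralAdj G (inj₁ u) (inj₁ x)) → adj G u x ≡ false
  nonadjacent⇒adj≡false p = Equivalence.to T-not-≡ (proj₁ (Equivalence.to T-∧ p))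

  nonadjacent : ∀ {u x} → u ≢ x → adj G u x ≡ false → T (centralAdj G (inj₁ u) (inj₁ x))
  nonadjacent {u} {x} u≢x ¬adj =
    Equivalence.from T-∧ (Equivalence.from T-not-≡ ¬adj , fromWitnessFalse {a? = u ≟ᶠ x} u≢x)

  adjacent⇒≢ : ∀ {u z} → T (adj G u z) → u ≢ z
  adjacent⇒≢ {u} u~z refl = subst T (irrefl G u) u~z

  nonadjacent≢adjacent : ∀ {u x z} → adj G u x ≡ false → T (adj G u z) → x ≢ z
  nonadjacent≢adjacent {u} u≁x u~z refl = subst T u≁x u~z

  ∈ₑ-adj : ∀ {x y e} → x ≢ y → x ∈ₑ e → y ∈ₑ e → T (adj G x y)
  ∈ₑ-adj {e = e} _   (at-lower refl) (at-upper refl) = lower-adj-upper e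
  ∈ₑ-adj {e = e} _   (at-upper refl) (at-lower refl) =
    subst T (SimpleGraph.sym G _ _) (lower-adj-upper e)
  ∈ₑ-adj         x≢y (at-lower refl) (at-lower refl) = ⊥-elim (x≢y refl)
  ∈ₑ-adj         x≢y (at-upper refl) (at-upper refl) = ⊥-elim (x≢y refl)

  ∈ₑ-other : ∀ {u x y e} → u ∈ₑ e → x ∈ₑ e → y ∈ₑ e → x ≢ u → y ≢ u → x ≡ y
  ∈ₑ-other _               (at-lower refl) (at-lower refl) _   _   = refl
  ∈ₑ-other _               (at-upper refl) (at-upper refl) _   _   = refl
  ∈ₑ-other (at-lower refl) (at-lower refl) (at-upper refl) x≢u _   = ⊥-elim (x≢u refl)
  ∈ₑ-other (at-upper refl) (at-lower refl) (at-upper refl) _   y≢u = ⊥-elim (y≢u refl)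
  ∈ₑ-other (at-lower refl) (at-upper refl) (at-lower refl) _   y≢u = ⊥-elim (y≢u refl)
  ∈ₑ-other (at-upper refl) (at-upper refl) (at-lower refl) x≢u _   = ⊥-elim (x≢u refl)

  -- the crossing cases contradict lower < upper
  ∈ₑ-unique : ∀ {x y e e'} → x ≢ y → x ∈ₑ e → y ∈ₑ e → x ∈ₑ e' → y ∈ₑ e' → e ≡ e'
  ∈ₑ-unique x≢y (at-lower refl) (at-lower refl) _ _ = ⊥-elim (x≢y refl)
  ∈ₑ-unique x≢y (at-upper refl) (at-upper refl) _ _ = ⊥-elim (x≢y refl)
  ∈ₑ-unique x≢y _ _ (at-lower p) (at-lower q) = ⊥-elim (x≢y (trans p (sym q)))
  ∈ₑ-unique x≢y _ _ (at-upper p) (at-upper q) = ⊥-elim (x≢y (trans p (sym q)))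
  ∈ₑ-unique {e = e} {e'} _ (at-lower refl) (at-upper refl) (at-lower p) (at-upper q) =
    edgeVertex-≡ e e' p q
  ∈ₑ-unique {e = e} {e'} _ (at-upper refl) (at-lower refl) (at-upper p) (at-lower q) =
    edgeVertex-≡ e e' q p
  ∈ₑ-unique {e = e} {e'} _ (at-lower refl) (at-upper refl) (at-upper p) (at-lower q) =
    ⊥-elim (<-asym (lower<upper e) (subst₂ _<_ (sym q) (sym p) (lower<upper e')))
  ∈ₑ-unique {e = e} {e'} _ (at-upper refl) (at-lower refl) (at-lower p) (at-upper q) =
    ⊥-elim (<-asym (lower<upper e) (subst₂ _<_ (sym p) (sym q) (lower<upper e')))

  edgeVertexBetween : ∀ {x y} → x ≢ y → T (adj G x y) → ∃ λ e → x ∈ₑ e × y ∈ₑ e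
  edgeVertexBetween {x} {y} x≢y p with <-cmp x y
  ... | tri< x<y _ _ = edgeVertex x<y p , at-lower refl , at-upper refl
  ... | tri≈ _ x≡y _ = ⊥-elim (x≢y x≡y)
  ... | tri> _ _ y<x = edgeVertex y<x (subst T (SimpleGraph.sym G x y) p) , at-upper refl , at-lower refl

  neighbour⇒edgeVertex : ∀ {u z} → T (adj G u z) → EdgeVertex G
  neighbour⇒edgeVertex u~z = proj₁ (edgeVertexBetween (adjacent⇒≢ u~z) u~z)

  opposite : Fin (n G) → EdgeVertex G → Fin (n G)
  opposite u e with u ≟ᶠ lower e
  ... | yes _ = upper e
  ... | no  _ = lower e

  opposite-∈ₑ : ∀ u e → opposite u e ∈ₑ e
  opposite-∈ₑ u e with u ≟ᶠ lower e
  ... | yes _ = at-upper refl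
  ... | no  _ = at-lower refl

  opposite≢ : ∀ {u e} → u ∈ₑ e → opposite u e ≢ u
  opposite≢ {u} {e} u∈e with u ≟ᶠ lower e | u∈e
  ... | yes u≡l | _        = λ h≡u → lower≢upper e (trans (sym u≡l) (sym h≡u))
  ... | no  u≢l | at-lower u≡l = ⊥-elim (u≢l u≡l)
  ... | no  _   | at-upper u≡h = λ l≡u → lower≢upper e (trans l≡u u≡h)

  farEnd : ∀ u → Neighbours (Central G) (inj₁ u) → Fin (n G)
  farEnd u (inj₁ x , _) = x
  farEnd u (inj₂ e , _) = opposite u e

  farEnd≢ : ∀ u w → farEnd u w ≢ u
  farEnd≢ u (inj₁ x , p) = nonadjacent⇒≢ p ∘ sym
  farEnd≢ u (inj₂ e , p) = opposite≢ (incident⇒∈ₑ u e p)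

  adj-opposite : ∀ {u e} → u ∈ₑ e → T (adj G u (opposite u e))
  adj-opposite {u} {e} u∈e = ∈ₑ-adj (opposite≢ u∈e ∘ sym) u∈e (opposite-∈ₑ u e)

  farEnd-injective : ∀ u → Injective _≡_ _≡_ (farEnd u)
  farEnd-injective u {inj₁ x , p} {inj₁ y , q} x≡y =
    neighbour-≡ {Central G} {inj₁ u} (cong inj₁ x≡y)
  farEnd-injective u {inj₁ x , p} {inj₂ e , q} x≡o =
    ⊥-elim (nonadjacent≢adjacent (nonadjacent⇒adj≡false p) (adj-opposite (incident⇒∈ₑ u e q)) x≡o)
  farEnd-injective u {inj₂ e , p} {inj₁ x , q} o≡x =
    ⊥-elim (nonadjacent≢adjacent (nonadjacent⇒adj≡false q) (adj-opposite (incident⇒∈ₑ u e p)) (sym o≡x))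
  farEnd-injective u {inj₂ e , p} {inj₂ e' , q} o≡o' =
    neighbour-≡ {Central G} {inj₁ u} (cong inj₂
      (∈ₑ-unique (opposite≢ u∈e ∘ sym) u∈e (opposite-∈ₑ u e)
                 (incident⇒∈ₑ u e' q) (subst (_∈ₑ e') (sym o≡o') (opposite-∈ₑ u e'))))
    where u∈e = incident⇒∈ₑ u e p

  farEnd-onto : ∀ u x → x ≢ u → ∃ λ w → farEnd u w ≡ x
  farEnd-onto u x x≢u with adj G u x in eq
  ... | false = (inj₁ x , nonadjacent (x≢u ∘ sym) eq) , refl
  ... | true with edgeVertexBetween (x≢u ∘ sym) (subst T (sym eq) tt)
  ...   | e , u∈e , x∈e =
          (inj₂ e , ∈ₑ⇒incident u∈e) ,
          ∈ₑ-other u∈e (opposite-∈ₑ u e) x∈e (opposite≢ u∈e) x≢u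

  degree-original : ∀ u → HasDegree (Central G) (inj₁ u) (pred (n G))
  degree-original u = punctured↔ u (farEnd u) (farEnd-injective u) (farEnd≢ u) (farEnd-onto u)

  degree-edge : ∀ e → HasDegree (Central G) (inj₂ e) 2
  degree-edge e = mk↔ₛ′ to from to-from from-to
    where
    side : ∀ {c} → c ∈ₑ e → Fin 2
    side (at-lower _) = zero
    side (at-upper _) = suc zero
    to : Neighbours (Central G) (inj₂ e) → Fin 2
    to (inj₁ c , p) = side (incident⇒∈ₑ c e p)
    from : Fin 2 → Neighbours (Central G) (inj₂ e)
    from zero       = inj₁ (lower e) , ∈ₑ⇒incident {lower e} {e} (at-lower refl)
    from (suc zero) = inj₁ (upper e) , ∈ₑ⇒incident {upper e} {e} (at-upper refl)
    to-from : ∀ i → to (from i) ≡ i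
    to-from zero       = side-lower _
      where
      side-lower : (l∈e : lower e ∈ₑ e) → side l∈e ≡ zero
      side-lower (at-lower _)   = refl
      side-lower (at-upper l≡h) = ⊥-elim (lower≢upper e l≡h)
    to-from (suc zero) = side-upper _
      where
      side-upper : (h∈e : upper e ∈ₑ e) → side h∈e ≡ suc zero
      side-upper (at-lower h≡l) = ⊥-elim (lower≢upper e (sym h≡l))
      side-upper (at-upper _)   = refl
    from-to : ∀ w → from (to w) ≡ w
    from-to (inj₁ c , p) with incident⇒∈ₑ c e p
    ... | at-lower c≡l = neighbour-≡ {Central G} {inj₂ e} (cong inj₁ (sym c≡l))
    ... | at-upper c≡h = neighbour-≡ {Central G} {inj₂ e} (cong inj₁ (sym c≡h))

  isMaxDegree-central : ∀ {Δ} v → HasDegree (Central G) v Δ →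
                        pred (n G) ≤ℕ Δ → (EdgeVertex G → 2 ≤ℕ Δ) → IsMaxDegree (Central G) Δ
  isMaxDegree-central v dv n-1≤Δ 2≤Δ = isMaxDegree v dv λ
    { (inj₁ u) → _ , degree-original u , n-1≤Δ
    ; (inj₂ e) → _ , degree-edge e , 2≤Δ e }

  fixing-originals⇒identity : (a : Automorphism (Central G)) →
                              (∀ u → φ a (inj₁ u) ≡ inj₁ u) → ∀ v → φ a v ≡ v
  fixing-originals⇒identity a fixed (inj₁ u) = fixed u
  fixing-originals⇒identity a fixed (inj₂ e) with φ a (inj₂ e) in eq
  ... | inj₁ c  = case φ-injective a (trans (fixed c) (sym eq)) of λ ()
  ... | inj₂ e' = cong inj₂ (sym (∈ₑ-unique (lower≢upper e) (at-lower refl) (at-upper refl)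
                                   (stays-incident (at-lower refl)) (stays-incident (at-upper refl))))
    where
    stays-incident : ∀ {c} → c ∈ₑ e → c ∈ₑ e'
    stays-incident {c} c∈e = incident⇒∈ₑ c e' (subst T
      (trans (sym (preserve a (inj₁ c) (inj₂ e))) (cong₂ (centralAdj G) (fixed c) eq))
      (∈ₑ⇒incident c∈e))

  isDistinguishing-central : ∀ {d} (f : TotalColoring (Central G) d) →
    (∀ {u x} → vcol f (inj₁ u) ≡ vcol f (inj₁ x) → u ≡ x) →
    (∀ a → Preserves a f → ∀ u e → φ a (inj₁ u) ≢ inj₂ e) →
    IsDistinguishing f
  isDistinguishing-central f vcol-injective stays-original a preserves =
    fixing-originals⇒identity a fixed
    where
    fixed : ∀ u → φ a (inj₁ u) ≡ inj₁ u
    fixed u with φ a (inj₁ u) in eq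
    ... | inj₁ x =
      cong inj₁ (vcol-injective (trans (cong (vcol f) (sym eq)) (proj₁ preserves (inj₁ u))))
    ... | inj₂ e = ⊥-elim (stays-original a preserves u e eq)

  vertex-retract : Fin (n G) → Fin (n G + n G * n G) ↩ V (Central G)
  vertex-retract u₀ = mk↩ {to = decode} {from = encode} (λ { refl → decode-encode _ })
                      ↩-∘ ↔⇒↩ ((↔-id _ ⊎-↔ *↔×) ↔-∘ +↔⊎)
    where
    decode : Fin (n G) ⊎ (Fin (n G) × Fin (n G)) → V (Central G)
    decode (inj₁ u) = inj₁ u
    decode (inj₂ (a , b)) with T? ((toℕ a <ᵇ toℕ b) ∧ adj G a b)
    ... | yes p = inj₂ ((a , b) , p)
    ... | no  _ = inj₁ u₀
    encode : V (Central G) → Fin (n G) ⊎ (Fin (n G) × Fin (n G))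
    encode (inj₁ u)          = inj₁ u
    encode (inj₂ (ab , _)) = inj₂ ab
    decode-encode : ∀ v → decode (encode v) ≡ v
    decode-encode (inj₁ u) = refl
    decode-encode (inj₂ ((a , b) , p)) with T? ((toℕ a <ᵇ toℕ b) ∧ adj G a b)
    ... | yes p' = cong (λ q → inj₂ ((a , b) , q)) (T-irrelevant p' p)
    ... | no ¬p  = ⊥-elim (¬p p)

  AtMostOneNonNeighbour : Set
  AtMostOneNonNeighbour =
    ∀ {u x y} → x ≢ u → y ≢ u → adj G u x ≡ false → adj G u y ≡ false → x ≡ y

  module _ (few : AtMostOneNonNeighbour) where

    label-coloring : TotalColoring (Central G) (suc (n G))
    label-coloring = record { vcol = vc ; ecol = ec ; ecolSym = ec-sym }
      where
      vc : V (Central G) → Fin (suc (n G))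
      vc (inj₁ u) = inject₁ u
      vc (inj₂ _) = fromℕ _
      ec : ∀ v w → T (centralAdj G v w) → Fin (suc (n G))
      ec (inj₁ u) (inj₁ x) _ = fromℕ _
      ec (inj₁ u) (inj₂ e) _ = inject₁ (opposite u e)
      ec (inj₂ e) (inj₁ u) _ = inject₁ (opposite u e)
      ec (inj₂ _) (inj₂ _) ()
      ec-sym : ∀ v w p q → ec v w p ≡ ec w v q
      ec-sym (inj₁ u) (inj₁ x) _ _ = refl
      ec-sym (inj₁ u) (inj₂ e) _ _ = refl
      ec-sym (inj₂ e) (inj₁ u) _ _ = refl
      ec-sym (inj₂ _) (inj₂ _) ()

    label-coloring-proper : IsProper label-coloring
    label-coloring-proper = record { vertexProper = vp ; edgeProper = ep ; incidence = ip }
      where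
      open TotalColoring label-coloring using () renaming (vcol to vc; ecol to ec)
      vp : ∀ v w → T (centralAdj G v w) → vc v ≢ vc w
      vp (inj₁ u) (inj₁ x) p = nonadjacent⇒≢ p ∘ inject₁-injective
      vp (inj₁ u) (inj₂ e) _ = fromℕ≢inject₁ ∘ sym
      vp (inj₂ e) (inj₁ u) _ = fromℕ≢inject₁
      vp (inj₂ _) (inj₂ _) ()
      ep : ∀ v w w' (p : T (centralAdj G v w)) (q : T (centralAdj G v w')) → w ≢ w' → ec v w p ≢ ec v w' q
      ep (inj₁ u) (inj₁ x) (inj₁ y) p q x≢y _ =
        x≢y (cong inj₁ (few (nonadjacent⇒≢ p ∘ sym) (nonadjacent⇒≢ q ∘ sym)
                            (nonadjacent⇒adj≡false p) (nonadjacent⇒adj≡false q)))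
      ep (inj₁ u) (inj₁ x) (inj₂ e) _ _ _ = fromℕ≢inject₁
      ep (inj₁ u) (inj₂ e) (inj₁ y) _ _ _ = fromℕ≢inject₁ ∘ sym
      ep (inj₁ u) (inj₂ e) (inj₂ e') p q e≢e' =
        e≢e' ∘ cong proj₁ ∘ farEnd-injective u {inj₂ e , p} {inj₂ e' , q} ∘ inject₁-injective
      ep (inj₂ e) (inj₁ c) (inj₁ c') p q c≢c' eq = opposite≢ c'∈e (sym
        (trans (∈ₑ-other c∈e c'∈e (opposite-∈ₑ c e) (c≢c' ∘ cong inj₁ ∘ sym)
                         (opposite≢ c∈e))
               (inject₁-injective eq)))
        where
        c∈e  = incident⇒∈ₑ c e p
        c'∈e = incident⇒∈ₑ c' e q
      ep (inj₂ _) (inj₁ _) (inj₂ _) _ ()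
      ep (inj₂ _) (inj₂ _) _ ()
      ip : ∀ v w (p : T (centralAdj G v w)) → ec v w p ≢ vc v
      ip (inj₁ u) (inj₁ x) _ = fromℕ≢inject₁
      ip (inj₁ u) (inj₂ e) p = opposite≢ (incident⇒∈ₑ u e p) ∘ inject₁-injective
      ip (inj₂ e) (inj₁ u) _ = fromℕ≢inject₁ ∘ sym
      ip (inj₂ _) (inj₂ _) ()

    label-coloring-distinguishing : IsDistinguishing label-coloring
    label-coloring-distinguishing = isDistinguishing-central label-coloring inject₁-injective
      λ a (pv , _) u e φu≡e →
        fromℕ≢inject₁ (trans (cong (vcol label-coloring) (sym φu≡e)) (pv (inj₁ u)))

    label-TD : HasTDColoring (Central G) (suc (n G))
    label-TD = label-coloring , label-coloring-proper , label-coloring-distinguishing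

  LowerNeighbour : Fin (n G) → Pred (Fin (n G)) 0ℓ
  LowerNeighbour b y = y < b × T (adj G b y)

  lowerNeighbour? : ∀ b → Decidable (LowerNeighbour b)
  lowerNeighbour? b y = y <? b ×-dec T? (adj G b y)

  successor : Fin (n G) → Fin (n G) → Fin (n G)
  successor b a with least-above (lowerNeighbour? b) a
  ... | inj₁ (y , _) = y
  ... | inj₂ _       = b

  <-successor : ∀ {a b} → a < b → a < successor b a
  <-successor {a} {b} a<b with least-above (lowerNeighbour? b) a
  ... | inj₁ (_ , a<y , _) = a<y
  ... | inj₂ _             = a<b

  successor-adj-or-self : ∀ b a → T (adj G b (successor b a)) ⊎ successor b a ≡ b
  successor-adj-or-self b a with least-above (lowerNeighbour? b) a
  ... | inj₁ (_ , _ , (_ , b~y) , _) = inj₁ b~y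
  ... | inj₂ _                       = inj₂ refl

  successor≤ : ∀ b a → successor b a ≤ b
  successor≤ b a with least-above (lowerNeighbour? b) a
  ... | inj₁ (_ , _ , (y<b , _) , _) = <⇒≤ y<b
  ... | inj₂ _                       = ≤-refl

  successor-minimal : ∀ {a a' b} → a < a' → LowerNeighbour b a' → successor b a ≤ a'
  successor-minimal {a} {a'} {b} a<a' a'∈ with least-above (lowerNeighbour? b) a
  ... | inj₁ (_ , _ , _ , least) = least a' a<a' a'∈
  ... | inj₂ none                = ⊥-elim (none a' a<a' a'∈)

  successor-injective : ∀ {a a' b} → LowerNeighbour b a → LowerNeighbour b a' →
                        successor b a ≡ successor b a' → a ≡ a'
  successor-injective {a} {a'} a∈@(a<b , _) a'∈@(a'<b , _) eq with <-cmp a a'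
  ... | tri≈ _ a≡a' _ = a≡a'
  ... | tri< a<a' _ _ =
    ⊥-elim (<⇒≱ (<-successor a'<b) (subst (_≤ a') eq (successor-minimal a<a' a'∈)))
  ... | tri> _ _ a'<a =
    ⊥-elim (<⇒≱ (<-successor a<b) (subst (_≤ a) (sym eq) (successor-minimal a'<a a∈)))

  lower∈lowerNeighbours : ∀ e → LowerNeighbour (upper e) (lower e)
  lower∈lowerNeighbours e = lower<upper e , subst T (SimpleGraph.sym G _ _) (lower-adj-upper e)

  -- The edge from u to w_{a,b} (a < b) will get color u + slot: at a the slot is b, at b it is the
  -- next lower neighbour of b after a, or b itself, which differs from a and from the other slots at b.
  slotAt : ∀ {u e} → u ∈ₑ e → Fin (n G)
  slotAt {e = e} (at-lower _) = upper e
  slotAt {e = e} (at-upper _) = successor (upper e) (lower e)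

  slotAt-adj-or-self : ∀ {u e} (u∈e : u ∈ₑ e) → T (adj G u (slotAt u∈e)) ⊎ slotAt u∈e ≡ u
  slotAt-adj-or-self {e = e} (at-lower refl) = inj₁ (lower-adj-upper e)
  slotAt-adj-or-self {e = e} (at-upper refl) = successor-adj-or-self (upper e) (lower e)

  slotAt-injective : ∀ {u e e'} (u∈e : u ∈ₑ e) (u∈e' : u ∈ₑ e') →
                     slotAt u∈e ≡ slotAt u∈e' → e ≡ e'
  slotAt-injective {e = e} {e'} (at-lower l≡u) (at-lower l'≡u) eq =
    edgeVertex-≡ e e' (trans (sym l≡u) l'≡u) eq
  slotAt-injective {e = e} {e'} (at-upper refl) (at-upper h≡h') eq =
    edgeVertex-≡ e e' (successor-injective (lower∈lowerNeighbours e) l'∈ s≡s') h≡h'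
    where
    l'∈ = subst (λ b → LowerNeighbour b (lower e')) (sym h≡h') (lower∈lowerNeighbours e')
    s≡s' = trans eq (cong (λ b → successor b (lower e')) (sym h≡h'))
  slotAt-injective {e = e} {e'} (at-lower refl) (at-upper l≡h') eq =
    ⊥-elim (<⇒≱ (lower<upper e) (subst₂ _≤_ (sym eq) (sym l≡h') (successor≤ (upper e') (lower e'))))
  slotAt-injective {e = e} {e'} (at-upper refl) (at-lower l'≡h) eq =
    ⊥-elim (<⇒≱ (lower<upper e') (subst₂ _≤_ eq l'≡h (successor≤ (upper e) (lower e))))

  slot : ∀ u → Neighbours (Central G) (inj₁ u) → Fin (n G)
  slot u (inj₁ x , _) = x
  slot u (inj₂ e , p) = slotAt (incident⇒∈ₑ u e p)

  nonadjacent≢slotAt : ∀ {u x e} → T (centralAdj G (inj₁ u) (inj₁ x)) → (u∈e : u ∈ₑ e) →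
                       x ≢ slotAt u∈e
  nonadjacent≢slotAt p u∈e x≡s with slotAt-adj-or-self u∈e
  ... | inj₁ u~s = nonadjacent≢adjacent (nonadjacent⇒adj≡false p) u~s x≡s
  ... | inj₂ s≡u = nonadjacent⇒≢ p (sym (trans x≡s s≡u))

  slot-injective : ∀ u → Injective _≡_ _≡_ (slot u)
  slot-injective u {inj₁ x , p} {inj₁ y , q} x≡y =
    neighbour-≡ {Central G} {inj₁ u} (cong inj₁ x≡y)
  slot-injective u {inj₁ x , p} {inj₂ e , q} eq =
    ⊥-elim (nonadjacent≢slotAt p (incident⇒∈ₑ u e q) eq)
  slot-injective u {inj₂ e , p} {inj₁ x , q} eq =
    ⊥-elim (nonadjacent≢slotAt q (incident⇒∈ₑ u e p) (sym eq))
  slot-injective u {inj₂ e , p} {inj₂ e' , q} eq =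
    neighbour-≡ {Central G} {inj₁ u}
      (cong inj₂ (slotAt-injective (incident⇒∈ₑ u e p) (incident⇒∈ₑ u e' q) eq))

  module _ (4≤n : 4 ≤ℕ n G) where

    vertexColor : Fin (n G) → Fin (suc (n G))
    vertexColor u = inject₁ u ⊕ fromℕ _

    edgeColorAt : ∀ {u e} → u ∈ₑ e → Fin (suc (n G))
    edgeColorAt {u} u∈e = inject₁ u ⊕ inject₁ (slotAt u∈e)

    private
      avoided : EdgeVertex G → Fin 4 → Fin (suc (n G))
      avoided e = edgeColorAt {lower e} {e} (at-lower refl) ∷
                  edgeColorAt {upper e} {e} (at-upper refl) ∷
                  vertexColor (lower e) ∷ vertexColor (upper e) ∷ []

    edgeVertexColor : EdgeVertex G → Fin (suc (n G))
    edgeVertexColor e = proj₁ (missing-color (s≤s 4≤n) (avoided e))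

    avoids : ∀ e i → avoided e i ≢ edgeVertexColor e
    avoids e = proj₂ (missing-color (s≤s 4≤n) (avoided e))

    avoids-ends : ∀ {u e} → u ∈ₑ e → vertexColor u ≢ edgeVertexColor e
    avoids-ends {e = e} (at-lower refl) = avoids e (suc (suc zero))
    avoids-ends {e = e} (at-upper refl) = avoids e (suc (suc (suc zero)))

    avoids-edges : ∀ {u e} (u∈e : u ∈ₑ e) → edgeColorAt u∈e ≢ edgeVertexColor e
    avoids-edges {e = e} (at-lower refl) = avoids e zero
    avoids-edges {e = e} (at-upper refl) = avoids e (suc zero)

    vertexColor-injective : Injective _≡_ _≡_ vertexColor
    vertexColor-injective {u} {x} eq = inject₁-injective (⊕-cancelˡ (fromℕ _)
      (trans (⊕-comm (fromℕ _) (inject₁ u)) (trans eq (⊕-comm (inject₁ x) (fromℕ _)))))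

    edgeColorAt-distinct : ∀ {c c' e} (c∈e : c ∈ₑ e) (c'∈e : c' ∈ₑ e) → c ≢ c' →
                            edgeColorAt c∈e ≢ edgeColorAt c'∈e
    edgeColorAt-distinct (at-lower refl) (at-lower refl) c≢c' = ⊥-elim (c≢c' refl)
    edgeColorAt-distinct (at-upper refl) (at-upper refl) c≢c' = ⊥-elim (c≢c' refl)
    edgeColorAt-distinct {e = e} (at-lower refl) (at-upper refl) _ eq =
      <-irrefl (inject₁-injective (⊕-cancelˡ (inject₁ (upper e))
                 (trans (⊕-comm (inject₁ (upper e)) (inject₁ (lower e))) eq)))
               (<-successor (lower<upper e))
    edgeColorAt-distinct {e = e} (at-upper refl) (at-lower refl) c≢c' =
      edgeColorAt-distinct {e = e} (at-lower refl) (at-upper refl) (c≢c' ∘ sym) ∘ sym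

    -- On the original vertices this is the total coloring u ↦ u + n, {u, x} ↦ u + x of the
    -- complete graph modulo n + 1; the color u + slot of an edge at u is free since slot u is injective.
    modular-coloring : TotalColoring (Central G) (suc (n G))
    modular-coloring = record { vcol = vc ; ecol = ec ; ecolSym = ec-sym }
      where
      vc : V (Central G) → Fin (suc (n G))
      vc (inj₁ u) = vertexColor u
      vc (inj₂ e) = edgeVertexColor e
      ec : ∀ v w → T (centralAdj G v w) → Fin (suc (n G))
      ec (inj₁ u) w        p = inject₁ u ⊕ inject₁ (slot u (w , p))
      ec (inj₂ e) (inj₁ u) p = edgeColorAt (incident⇒∈ₑ u e p)
      ec (inj₂ _) (inj₂ _) ()
      ec-sym : ∀ v w p q → ec v w p ≡ ec w v q
      ec-sym (inj₁ u) (inj₁ x) _ _ = ⊕-comm (inject₁ u) (inject₁ x)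
      ec-sym (inj₁ u) (inj₂ e) p q = cong (edgeColorAt ∘ incident⇒∈ₑ u e) (T-irrelevant p q)
      ec-sym (inj₂ e) (inj₁ u) p q = cong (edgeColorAt ∘ incident⇒∈ₑ u e) (T-irrelevant p q)
      ec-sym (inj₂ _) (inj₂ _) ()

    modular-coloring-proper : IsProper modular-coloring
    modular-coloring-proper = record { vertexProper = vp ; edgeProper = ep ; incidence = ip }
      where
      open TotalColoring modular-coloring using () renaming (vcol to vc; ecol to ec)
      vp : ∀ v w → T (centralAdj G v w) → vc v ≢ vc w
      vp (inj₁ u) (inj₁ x) p = nonadjacent⇒≢ p ∘ vertexColor-injective
      vp (inj₁ u) (inj₂ e) p = avoids-ends (incident⇒∈ₑ u e p)
      vp (inj₂ e) (inj₁ u) p = avoids-ends (incident⇒∈ₑ u e p) ∘ sym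
      vp (inj₂ _) (inj₂ _) ()
      ep : ∀ v w w' (p : T (centralAdj G v w)) (q : T (centralAdj G v w')) → w ≢ w' → ec v w p ≢ ec v w' q
      ep (inj₁ u) w w' p q w≢w' =
        w≢w' ∘ cong proj₁ ∘ slot-injective u {w , p} {w' , q} ∘ inject₁-injective
             ∘ ⊕-cancelˡ (inject₁ u)
      ep (inj₂ e) (inj₁ c) (inj₁ c') p q c≢c' =
        edgeColorAt-distinct (incident⇒∈ₑ c e p) (incident⇒∈ₑ c' e q) (c≢c' ∘ cong inj₁)
      ep (inj₂ _) (inj₁ _) (inj₂ _) _ ()
      ep (inj₂ _) (inj₂ _) _ ()
      ip : ∀ v w (p : T (centralAdj G v w)) → ec v w p ≢ vc v
      ip (inj₁ u) w p = fromℕ≢inject₁ ∘ sym ∘ ⊕-cancelˡ (inject₁ u)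
      ip (inj₂ e) (inj₁ u) p = avoids-edges (incident⇒∈ₑ u e p)
      ip (inj₂ _) (inj₂ _) ()

    -- original vertices have degree n - 1 ≥ 3, edge vertices degree 2
    modular-coloring-distinguishing : IsDistinguishing modular-coloring
    modular-coloring-distinguishing = isDistinguishing-central modular-coloring vertexColor-injective
      λ a _ u e φu≡e →
        let n-1≡2 = degree-unique {Central G} {inj₂ e}
                      (subst (λ v → HasDegree (Central G) v _) φu≡e (degree-preserved a (degree-original u)))
                      (degree-edge e)
        in case subst (3 ≤ℕ_) n-1≡2 (pred-mono-≤ 4≤n) of λ { (s≤s (s≤s ())) }

    modular-TD : HasTDColoring (Central G) (suc (n G))
    modular-TD = modular-coloring , modular-coloring-proper , modular-coloring-distinguishing

central-maxDegree-TDColoring : ∀ G → Connected G →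
  ∃ λ Δ → IsMaxDegree (Central G) Δ × HasTDColoring (Central G) (suc (suc Δ))
central-maxDegree-TDColoring record { n = 0 } (() , _)
central-maxDegree-TDColoring G@record { n = 1 } _ =
  0 , isMaxDegree-central (inj₁ zero) (degree-original zero) ≤-refl (λ { ((zero , zero) , ()) }) ,
  label-TD λ { {zero} {zero} x≢u _ _ _ → ⊥-elim (x≢u refl) }
  where open CentralGraph G
central-maxDegree-TDColoring G@record { n = 2 } conn =
  2 , isMaxDegree-central (inj₂ e) (degree-edge e) (s≤s z≤n) (λ _ → ≤-refl) ,
  hasTDColoring-mono (n≤1+n 3) (label-TD λ x≢u y≢u _ _ → Fin2-≢-unique x≢u y≢u)
  where
  open CentralGraph G
  e = neighbour⇒edgeVertex (proj₂ (connected⇒neighbour conn zero (suc zero) λ ()))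
central-maxDegree-TDColoring G@record { n = 3 } conn =
  2 , isMaxDegree-central (inj₁ zero) (degree-original zero) ≤-refl (λ _ → ≤-refl) ,
  label-TD λ {u} x≢u y≢u u≁x u≁y →
    let z , u~z = connected⇒neighbour conn u (punchIn u zero) (punchInᵢ≢i u zero ∘ sym)
    in Fin3-≢-unique x≢u y≢u (adjacent⇒≢ u~z ∘ sym)
                     (nonadjacent≢adjacent u≁x u~z) (nonadjacent≢adjacent u≁y u~z)
  where open CentralGraph G
central-maxDegree-TDColoring G@record { n = suc (suc (suc (suc k))) } _ =
  suc (suc (suc k)) ,
  isMaxDegree-central (inj₁ zero) (degree-original zero) ≤-refl (λ _ → s≤s (s≤s z≤n)) ,
  modular-TD (s≤s (s≤s (s≤s (s≤s z≤n))))
  where open CentralGraph G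

proposition4p4 : (G : SimpleGraph) → Connected G →
    Σ ℕ (λ Δ → IsMaxDegree (Central G) Δ ×
      (IsTDChromaticNumber (Central G) (suc Δ) ⊎ IsTDChromaticNumber (Central G) (suc (suc Δ))))
proposition4p4 G conn =
  let (Δ , maxDegree@((v , dv) , _) , more) = central-maxDegree-TDColoring G conn
      fewer? = FiniteGraph.hasTDColoring? (Central G)
                 (CentralGraph.vertex-retract G (fromℕ< (proj₁ conn))) (suc Δ)
  in Δ , maxDegree , isTDChromaticNumber-Δ+1⊎Δ+2 v dv more fewer?
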